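{- Let $R$ be a commutative ring with $1$, and let $\{u_n(q)\}_{n=1}^\infty$ and $\{v_m(q)\}_{m=1}^\infty$ be sequences of polynomials in $R[q]$ such that $[m+n]_q = u_n(q)[m]_q + v_m(q)[n]_q$ for all positive integers $m,n$. Then a sequence $\{f_n(q)\}_{n=1}^\infty$ of polynomials in $R[q]$ satisfies $f_{m+n}(q) = u_n(q)f_m(q) + v_m(q)f_n(q)$ for all positive integers $m,n$ if and only if there is a polynomial $h(q)\in R[q]$ such that $f_n(q)=h(q)[n]_q$ for all $n\ge 1$.
   Context: For a positive integer $n$, the quantum integer $[n]_q$ is the polynomial $1+q+q^2+\cdots+q^{n-1}$. -}

module Defs where

open import Level using (_⊔_)
open import Algebra.Bundles using (CommutativeRing)
open import Data.Nat using (ℕ; zero; suc)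
open import Data.List using (List; []; _∷_; map)

-- Univariate polynomials R[q] over a commutative ring R, represented by
-- coefficient lists (constant term first); equality is coefficientwise
-- (so trailing zeros are irrelevant).
module Poly {c ℓ} (R : CommutativeRing c ℓ) where
  open CommutativeRing R

  Polynomial : Set c
  Polynomial = List Carrier

  coeff : Polynomial → ℕ → Carrier
  coeff []      _       = 0#
  coeff (a ∷ p) zero    = a
  coeff (a ∷ p) (suc n) = coeff p n

  infix 4 _≋_
  _≋_ : Polynomial → Polynomial → Set ℓ
  p ≋ r = ∀ n → coeff p n ≈ coeff r n

  infixl 6 _⊕_
  _⊕_ : Polynomial → Polynomial → Polynomial
  []      ⊕ r       = r
  (a ∷ p) ⊕ []      = a ∷ p
  (a ∷ p) ⊕ (b ∷ r) = (a + b) ∷ (p ⊕ r)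

  infixl 7 _⊛_
  _⊛_ : Polynomial → Polynomial → Polynomial
  []      ⊛ r = []
  (a ∷ p) ⊛ r = map (a *_) r ⊕ (0# ∷ (p ⊛ r))

  qint : ℕ → Polynomial
  qint zero    = []
  qint (suc n) = 1# ∷ qint n

module Submission where

-- With m = 1 the recurrence reads f (1 + n) = u n f 1 + v 1 f n, so a solution
-- is determined on n ≥ 1 by f 1. Since R[q] is commutative, h [n]_q solves the
-- recurrence whenever [n]_q does, and as [1]_q = 1 the solution f must be
-- f 1 · [n]_q.

open import Defs
open import Algebra.Bundles using (CommutativeRing; CommutativeSemiring; CommutativeMonoid)
open import Data.Nat as ℕ using (ℕ; zero; suc; _≤_; s≤s; z≤n)
open import Data.Nat.Properties using (≤-trans; m≤m+n)
open import Data.List using ([]; _∷_; map)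
open import Data.Product using (∃; _,_; map₂)
open import Function.Bundles using (_⇔_; mk⇔; Equivalence)
open import Relation.Binary.Bundles using (Setoid)
open import Relation.Binary.Structures using (IsEquivalence)

module PolynomialSemiring {c ℓ} (R : CommutativeRing c ℓ) where
  open CommutativeRing R hiding (zero; commutativeSemiring)
  open Poly R

  -- _≋_ is a function type, so its two sides cannot be inferred from it;
  -- wrapping it in a record makes them inferable.
  infix 4 _≃_
  record _≃_ (p r : Polynomial) : Set ℓ where
    constructor coeffwise
    field coeff-≈ : p ≋ r
  open _≃_ public

  ≃-isEquivalence : IsEquivalence _≃_
  ≃-isEquivalence = record
    { refl  = coeffwise λ _ → refl
    ; sym   = λ (coeffwise p≋r) → coeffwise λ n → sym (p≋r n)
    ; trans = λ (coeffwise p≋r) (coeffwise r≋s) → coeffwise λ n → trans (p≋r n) (r≋s n)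
    }

  ≃-setoid : Setoid c ℓ
  ≃-setoid = record { isEquivalence = ≃-isEquivalence }

  open Setoid ≃-setoid public using () renaming (refl to ≃-refl; sym to ≃-sym; trans to ≃-trans)

  import Relation.Binary.Reasoning.Setoid setoid as ≈-Reasoning

  coeff-⊕ : ∀ p r n → coeff (p ⊕ r) n ≈ coeff p n + coeff r n
  coeff-⊕ []      r       n       = sym (+-identityˡ _)
  coeff-⊕ (a ∷ p) []      n       = sym (+-identityʳ _)
  coeff-⊕ (a ∷ p) (b ∷ r) zero    = refl
  coeff-⊕ (a ∷ p) (b ∷ r) (suc n) = coeff-⊕ p r n

  coeff-scale : ∀ a p n → coeff (map (a *_) p) n ≈ a * coeff p n
  coeff-scale a []      n       = sym (zeroʳ a)
  coeff-scale a (b ∷ p) zero    = refl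
  coeff-scale a (b ∷ p) (suc n) = coeff-scale a p n

  ∷-cong : ∀ {a b p r} → a ≈ b → p ≃ r → a ∷ p ≃ b ∷ r
  ∷-cong a≈b (coeffwise p≋r) = coeffwise λ { zero → a≈b ; (suc n) → p≋r n }

  0∷[]≃[] : 0# ∷ [] ≃ []
  0∷[]≃[] = coeffwise λ { zero → refl ; (suc n) → refl }

  ⊕-cong : ∀ {p p′ r r′} → p ≃ p′ → r ≃ r′ → p ⊕ r ≃ p′ ⊕ r′
  ⊕-cong {p} {p′} {r} {r′} (coeffwise p≋p′) (coeffwise r≋r′) = coeffwise λ n →
    trans (coeff-⊕ p r n) (trans (+-cong (p≋p′ n) (r≋r′ n)) (sym (coeff-⊕ p′ r′ n)))

  ⊕-assoc : ∀ p r s → (p ⊕ r) ⊕ s ≃ p ⊕ (r ⊕ s)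
  ⊕-assoc p r s = coeffwise λ n → begin
    coeff ((p ⊕ r) ⊕ s) n               ≈⟨ trans (coeff-⊕ (p ⊕ r) s n) (+-congʳ (coeff-⊕ p r n)) ⟩
    coeff p n + coeff r n + coeff s n   ≈⟨ +-assoc _ _ _ ⟩
    coeff p n + (coeff r n + coeff s n) ≈⟨ trans (coeff-⊕ p (r ⊕ s) n) (+-congˡ (coeff-⊕ r s n)) ⟨
    coeff (p ⊕ (r ⊕ s)) n               ∎
    where open ≈-Reasoning

  ⊕-comm : ∀ p r → p ⊕ r ≃ r ⊕ p
  ⊕-comm p r = coeffwise λ n →
    trans (coeff-⊕ p r n) (trans (+-comm _ _) (sym (coeff-⊕ r p n)))

  ⊕-identityʳ : ∀ p → p ⊕ [] ≃ p
  ⊕-identityʳ p = coeffwise λ n → trans (coeff-⊕ p [] n) (+-identityʳ _)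

  ⊕-commutativeMonoid : CommutativeMonoid c ℓ
  ⊕-commutativeMonoid = record
    { isCommutativeMonoid = isCommutativeMonoidˡ record
      { isSemigroup = record
        { isMagma = record { isEquivalence = ≃-isEquivalence ; ∙-cong = ⊕-cong }
        ; assoc   = ⊕-assoc
        }
      ; identityˡ = λ _ → ≃-refl
      ; comm      = ⊕-comm
      }
    }
    where open import Algebra.Structures.Biased _≃_

  open import Algebra.Properties.CommutativeSemigroup
    (CommutativeMonoid.commutativeSemigroup ⊕-commutativeMonoid)
    using (interchange; x∙yz≈y∙xz)

  scale-cong : ∀ {a b p r} → a ≈ b → p ≃ r → map (a *_) p ≃ map (b *_) r
  scale-cong {a} {b} {p} {r} a≈b (coeffwise p≋r) = coeffwise λ n →
    trans (coeff-scale a p n) (trans (*-cong a≈b (p≋r n)) (sym (coeff-scale b r n)))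

  scale-zero : ∀ p → map (0# *_) p ≃ []
  scale-zero p = coeffwise λ n → trans (coeff-scale 0# p n) (zeroˡ _)

  scale-distribʳ : ∀ a b p → map ((a + b) *_) p ≃ map (a *_) p ⊕ map (b *_) p
  scale-distribʳ a b p = coeffwise λ n → begin
    coeff (map ((a + b) *_) p) n                    ≈⟨ coeff-scale (a + b) p n ⟩
    (a + b) * coeff p n                             ≈⟨ distribʳ _ a b ⟩
    a * coeff p n + b * coeff p n                   ≈⟨ +-cong (coeff-scale a p n) (coeff-scale b p n) ⟨
    coeff (map (a *_) p) n + coeff (map (b *_) p) n ≈⟨ coeff-⊕ (map (a *_) p) (map (b *_) p) n ⟨
    coeff (map (a *_) p ⊕ map (b *_) p) n           ∎
    where open ≈-Reasoning

  scale-distribˡ : ∀ a p r → map (a *_) (p ⊕ r) ≃ map (a *_) p ⊕ map (a *_) r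
  scale-distribˡ a p r = coeffwise λ n → begin
    coeff (map (a *_) (p ⊕ r)) n                    ≈⟨ coeff-scale a (p ⊕ r) n ⟩
    a * coeff (p ⊕ r) n                             ≈⟨ *-congˡ (coeff-⊕ p r n) ⟩
    a * (coeff p n + coeff r n)                     ≈⟨ distribˡ a _ _ ⟩
    a * coeff p n + a * coeff r n                   ≈⟨ +-cong (coeff-scale a p n) (coeff-scale a r n) ⟨
    coeff (map (a *_) p) n + coeff (map (a *_) r) n ≈⟨ coeff-⊕ (map (a *_) p) (map (a *_) r) n ⟨
    coeff (map (a *_) p ⊕ map (a *_) r) n           ∎
    where open ≈-Reasoning

  scale-scale : ∀ a b p → map (a *_) (map (b *_) p) ≃ map ((a * b) *_) p
  scale-scale a b p = coeffwise λ n → begin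
    coeff (map (a *_) (map (b *_) p)) n ≈⟨ coeff-scale a (map (b *_) p) n ⟩
    a * coeff (map (b *_) p) n          ≈⟨ *-congˡ (coeff-scale b p n) ⟩
    a * (b * coeff p n)                 ≈⟨ *-assoc a b _ ⟨
    a * b * coeff p n                   ≈⟨ coeff-scale (a * b) p n ⟨
    coeff (map ((a * b) *_) p) n        ∎
    where open ≈-Reasoning

  open import Relation.Binary.Reasoning.Setoid ≃-setoid

  ⊛-zeroʳ : ∀ p → p ⊛ [] ≃ []
  ⊛-zeroʳ []      = ≃-refl
  ⊛-zeroʳ (a ∷ p) = ≃-trans (∷-cong refl (⊛-zeroʳ p)) 0∷[]≃[]

  ⊛-identityʳ : ∀ p → p ⊛ (1# ∷ []) ≃ p
  ⊛-identityʳ []      = ≃-refl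
  ⊛-identityʳ (a ∷ p) = ∷-cong (trans (+-identityʳ _) (*-identityʳ a)) (⊛-identityʳ p)

  ⊛-congʳ : ∀ p {r r′} → r ≃ r′ → p ⊛ r ≃ p ⊛ r′
  ⊛-congʳ []      r≃r′ = ≃-refl
  ⊛-congʳ (a ∷ p) r≃r′ = ⊕-cong (scale-cong refl r≃r′) (∷-cong refl (⊛-congʳ p r≃r′))

  ⊛-∷ʳ : ∀ p b r → p ⊛ (b ∷ r) ≃ map (b *_) p ⊕ (0# ∷ p ⊛ r)
  ⊛-∷ʳ []      b r = ≃-sym 0∷[]≃[]
  ⊛-∷ʳ (a ∷ p) b r = ∷-cong (+-congʳ (*-comm a b)) (begin
    map (a *_) r ⊕ p ⊛ (b ∷ r)                   ≈⟨ ⊕-cong ≃-refl (⊛-∷ʳ p b r) ⟩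
    map (a *_) r ⊕ (map (b *_) p ⊕ (0# ∷ p ⊛ r)) ≈⟨ x∙yz≈y∙xz (map (a *_) r) (map (b *_) p) _ ⟩
    map (b *_) p ⊕ (map (a *_) r ⊕ (0# ∷ p ⊛ r)) ∎)

  ⊛-comm : ∀ p r → p ⊛ r ≃ r ⊛ p
  ⊛-comm []      r = ≃-sym (⊛-zeroʳ r)
  ⊛-comm (a ∷ p) r = ≃-trans (⊕-cong ≃-refl (∷-cong refl (⊛-comm p r))) (≃-sym (⊛-∷ʳ r a p))

  ⊛-congˡ : ∀ {p p′} r → p ≃ p′ → p ⊛ r ≃ p′ ⊛ r
  ⊛-congˡ {p} {p′} r p≃p′ = ≃-trans (⊛-comm p r) (≃-trans (⊛-congʳ r p≃p′) (⊛-comm r p′))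

  ⊛-distribʳ : ∀ p r s → (r ⊕ s) ⊛ p ≃ r ⊛ p ⊕ s ⊛ p
  ⊛-distribʳ p []      s       = ≃-refl
  ⊛-distribʳ p (a ∷ r) []      = ≃-sym (⊕-identityʳ _)
  ⊛-distribʳ p (a ∷ r) (b ∷ s) = begin
    map ((a + b) *_) p ⊕ (0# ∷ (r ⊕ s) ⊛ p)
      ≈⟨ ⊕-cong (scale-distribʳ a b p) (∷-cong (sym (+-identityʳ 0#)) (⊛-distribʳ p r s)) ⟩
    (map (a *_) p ⊕ map (b *_) p) ⊕ ((0# ∷ r ⊛ p) ⊕ (0# ∷ s ⊛ p))
      ≈⟨ interchange (map (a *_) p) _ _ _ ⟩
    (map (a *_) p ⊕ (0# ∷ r ⊛ p)) ⊕ (map (b *_) p ⊕ (0# ∷ s ⊛ p)) ∎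

  scale-⊛ : ∀ a p r → map (a *_) p ⊛ r ≃ map (a *_) (p ⊛ r)
  scale-⊛ a []      r = ≃-refl
  scale-⊛ a (b ∷ p) r = begin
    map ((a * b) *_) r ⊕ (0# ∷ map (a *_) p ⊛ r)
      ≈⟨ ⊕-cong (≃-sym (scale-scale a b r)) (∷-cong (sym (zeroʳ a)) (scale-⊛ a p r)) ⟩
    map (a *_) (map (b *_) r) ⊕ map (a *_) (0# ∷ p ⊛ r)
      ≈⟨ scale-distribˡ a (map (b *_) r) _ ⟨
    map (a *_) (map (b *_) r ⊕ (0# ∷ p ⊛ r)) ∎

  0∷-⊛ : ∀ p r → (0# ∷ p) ⊛ r ≃ 0# ∷ p ⊛ r
  0∷-⊛ p r = ⊕-cong (scale-zero r) ≃-refl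

  ⊛-assoc : ∀ p r s → (p ⊛ r) ⊛ s ≃ p ⊛ (r ⊛ s)
  ⊛-assoc []      r s = ≃-refl
  ⊛-assoc (a ∷ p) r s = begin
    (map (a *_) r ⊕ (0# ∷ p ⊛ r)) ⊛ s          ≈⟨ ⊛-distribʳ s (map (a *_) r) _ ⟩
    map (a *_) r ⊛ s ⊕ (0# ∷ p ⊛ r) ⊛ s        ≈⟨ ⊕-cong (scale-⊛ a r s) (0∷-⊛ (p ⊛ r) s) ⟩
    map (a *_) (r ⊛ s) ⊕ (0# ∷ (p ⊛ r) ⊛ s)    ≈⟨ ⊕-cong ≃-refl (∷-cong refl (⊛-assoc p r s)) ⟩
    map (a *_) (r ⊛ s) ⊕ (0# ∷ p ⊛ (r ⊛ s))    ∎

  commutativeSemiring : CommutativeSemiring c ℓ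
  commutativeSemiring = record
    { Carrier = Polynomial
    ; _≈_     = _≃_
    ; _+_     = _⊕_
    ; _*_     = _⊛_
    ; 0#      = []
    ; 1#      = 1# ∷ []
    ; isCommutativeSemiring = isCommutativeSemiringˡ record
      { +-isCommutativeMonoid = CommutativeMonoid.isCommutativeMonoid ⊕-commutativeMonoid
      ; *-isCommutativeMonoid = isCommutativeMonoidʳ record
        { isSemigroup = record
          { isMagma = record
            { isEquivalence = ≃-isEquivalence
            ; ∙-cong = λ {p} {p′} {r} p≃p′ r≃r′ → ≃-trans (⊛-congˡ r p≃p′) (⊛-congʳ p′ r≃r′)
            }
          ; assoc = ⊛-assoc
          }
        ; identityʳ = ⊛-identityʳ
        ; comm      = ⊛-comm
        }
      ; distribʳ = ⊛-distribʳ
      ; zeroˡ    = λ _ → ≃-refl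
      }
    }
    where open import Algebra.Structures.Biased _≃_

module AdditiveRecurrence {c ℓ} (S : CommutativeSemiring c ℓ) where
  open CommutativeSemiring S
  open import Algebra.Properties.CommutativeSemigroup *-commutativeSemigroup using (x∙yz≈y∙xz)
  open import Relation.Binary.Reasoning.Setoid setoid

  Recurrence : (u v f : ℕ → Carrier) → Set ℓ
  Recurrence u v f = ∀ m n → 1 ≤ m → 1 ≤ n → f (m ℕ.+ n) ≈ u n * f m + v m * f n

  recurrence-*ˡ : ∀ {u v e} h → Recurrence u v e → Recurrence u v (λ n → h * e n)
  recurrence-*ˡ {u} {v} {e} h rec-e m n 1≤m 1≤n = begin
    h * e (m ℕ.+ n)                   ≈⟨ *-congˡ (rec-e m n 1≤m 1≤n) ⟩
    h * (u n * e m + v m * e n)       ≈⟨ distribˡ h _ _ ⟩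
    h * (u n * e m) + h * (v m * e n) ≈⟨ +-cong (x∙yz≈y∙xz h (u n) (e m)) (x∙yz≈y∙xz h (v m) (e n)) ⟩
    u n * (h * e m) + v m * (h * e n) ∎

  recurrence-resp : ∀ {u v f g} → (∀ n → 1 ≤ n → f n ≈ g n) → Recurrence u v f → Recurrence u v g
  recurrence-resp {u} {v} {f} {g} f≈g rec-f m n 1≤m 1≤n = begin
    g (m ℕ.+ n)               ≈⟨ f≈g (m ℕ.+ n) (≤-trans 1≤m (m≤m+n m n)) ⟨
    f (m ℕ.+ n)               ≈⟨ rec-f m n 1≤m 1≤n ⟩
    u n * f m + v m * f n     ≈⟨ +-cong (*-congˡ (f≈g m 1≤m)) (*-congˡ (f≈g n 1≤n)) ⟩
    u n * g m + v m * g n     ∎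

  recurrence-unique : ∀ {u v f g} → Recurrence u v f → Recurrence u v g → f 1 ≈ g 1 →
                      ∀ n → 1 ≤ n → f n ≈ g n
  recurrence-unique {u} {v} {f} {g} rec-f rec-g f₁≈g₁ (suc n) _ = at-suc n
    where
    at-suc : ∀ k → f (suc k) ≈ g (suc k)
    at-suc zero    = f₁≈g₁
    at-suc (suc k) = begin
      f (2 ℕ.+ k)                       ≈⟨ rec-f 1 (suc k) (s≤s z≤n) (s≤s z≤n) ⟩
      u (suc k) * f 1 + v 1 * f (suc k) ≈⟨ +-cong (*-congˡ f₁≈g₁) (*-congˡ (at-suc k)) ⟩
      u (suc k) * g 1 + v 1 * g (suc k) ≈⟨ rec-g 1 (suc k) (s≤s z≤n) (s≤s z≤n) ⟨
      g (2 ℕ.+ k)                       ∎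

  recurrence⇔multiple : ∀ {u v e} → Recurrence u v e → e 1 ≈ 1# → ∀ f →
                        Recurrence u v f ⇔ ∃ λ h → ∀ n → 1 ≤ n → f n ≈ h * e n
  recurrence⇔multiple {u} {v} {e} rec-e e₁≈1 f = mk⇔
    (λ rec-f → f 1 , recurrence-unique rec-f (recurrence-*ˡ (f 1) rec-e) f₁≈f₁*e₁)
    (λ (h , f≈h*e) → recurrence-resp (λ n 1≤n → sym (f≈h*e n 1≤n)) (recurrence-*ˡ h rec-e))
    where
    f₁≈f₁*e₁ : f 1 ≈ f 1 * e 1
    f₁≈f₁*e₁ = sym (trans (*-congˡ e₁≈1) (*-identityʳ (f 1)))

open import Data.Nat using (_+_)

theorem5 : ∀ {c ℓ} (R : CommutativeRing c ℓ) → let open Poly R in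
    (u v : ℕ → Polynomial) →
    (∀ m n → 1 ≤ m → 1 ≤ n → qint (m + n) ≋ u n ⊛ qint m ⊕ v m ⊛ qint n) →
    (f : ℕ → Polynomial) →
    ((∀ m n → 1 ≤ m → 1 ≤ n → f (m + n) ≋ u n ⊛ f m ⊕ v m ⊛ f n)
      ⇔ ∃ λ (h : Polynomial) → ∀ n → 1 ≤ n → f n ≋ h ⊛ qint n)
theorem5 R u v hq f = mk⇔
  (λ rec-f → map₂ (λ f≃h*q n 1≤n → coeff-≈ (f≃h*q n 1≤n))
                  (to λ m n 1≤m 1≤n → coeffwise (rec-f m n 1≤m 1≤n)))
  (λ (h , f≋h*q) m n 1≤m 1≤n →
     coeff-≈ (from (h , λ n 1≤n → coeffwise (f≋h*q n 1≤n)) m n 1≤m 1≤n))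
  where
  open Poly R using (qint)
  open PolynomialSemiring R
  open AdditiveRecurrence commutativeSemiring

  qint-recurrence : Recurrence u v qint
  qint-recurrence m n 1≤m 1≤n = coeffwise (hq m n 1≤m 1≤n)

  open Equivalence (recurrence⇔multiple {u} {v} {qint} qint-recurrence ≃-refl f)
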